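{- For every model $L$, $(L,\sqsubseteq)$ is a complete lattice.
   Context: Fix a limit ordinal $\kappa$. A stratified complete lattice is $(L,\leq,(\sqsubseteq_\alpha)_{\alpha<\kappa})$ with $(L,\leq)$ a complete lattice and each $\sqsubseteq_\alpha$ a preorder; $x=_\alpha y$ means $x\sqsubseteq_\alpha y$ and $y\sqsubseteq_\alpha x$. A model satisfies: (A1) for $\alpha<\beta<\kappa$, $x\sqsubseteq_\beta y$ implies $x=_\alpha y$; (A2) if $x=_\alpha y$ for all $\alpha$ then $x=y$; (A3) for all $x,\alpha$ there is $y$ with $x=_\alpha y$ such that $x\sqsubseteq_\alpha z$ implies $y\leq z$ (unique, denoted $x|_\alpha$); (A4) for nonempty $I$ and $x_i=_\alpha y$ ($i\in I$), $\bigvee_i x_i=_\alpha y$; (A5) $x\leq y$ implies $x|_\alpha\leq y|_\alpha$; (A6) if $x\leq y$ and $x=_\beta y$ for all $\beta<\alpha$ then $x\sqsubseteq_\alpha y$. On a model, $x\sqsubseteq y$ iff $x=y$ or there is $\alpha<\kappa$ with $x\sqsubseteq_\alpha y$ and not $y\sqsubseteq_\alpha x$. -}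

module Defs where

open import Level using (Level; _⊔_) renaming (suc to lsuc)
open import Data.Product using (Σ; ∃; _×_; _,_)
open import Data.Sum using (_⊎_)
open import Relation.Nullary using (¬_)
open import Relation.Unary using (Pred; _∈_)
open import Relation.Binary.PropositionalEquality using (_≡_)
open import Relation.Binary.Structures using (IsPreorder; IsPartialOrder; IsStrictTotalOrder)
open import Induction.WellFounded using (WellFounded)

module _ {ℓ : Level} {L : Set ℓ} where

  IsUpperBound : (L → L → Set ℓ) → Pred L ℓ → L → Set ℓ
  IsUpperBound _≼_ S u = ∀ x → x ∈ S → x ≼ u

  IsLub : (L → L → Set ℓ) → Pred L ℓ → L → Set ℓ
  IsLub _≼_ S u = IsUpperBound _≼_ S u × (∀ v → IsUpperBound _≼_ S v → u ≼ v)

  IsCompleteLattice : (L → L → Set ℓ) → Set (lsuc ℓ)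
  IsCompleteLattice _≼_ =
    IsPartialOrder _≡_ _≼_ × (∀ (S : Pred L ℓ) → Σ L (IsLub _≼_ S))

  Image : {I : Set ℓ} → (I → L) → Pred L ℓ
  Image {I} f z = Σ I (λ i → f i ≡ z)

-- The limit ordinal κ, represented (up to isomorphism) by its set of
-- predecessors: a nonempty well-ordered set without a greatest element.

record LimitOrdinal (ℓ : Level) : Set (lsuc ℓ) where
  field
    Ord        : Set ℓ
    _<_        : Ord → Ord → Set ℓ
    isSTO      : IsStrictTotalOrder _≡_ _<_
    wf         : WellFounded _<_
    nonempty   : Ord
    noGreatest : ∀ α → Σ Ord (λ β → α < β)

record Model {ℓ : Level} (κ : LimitOrdinal ℓ) : Set (lsuc ℓ) where
  open LimitOrdinal κ
  field
    Carrier    : Set ℓ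
    _≤_        : Carrier → Carrier → Set ℓ
    ≤-complete : IsCompleteLattice _≤_
    _⊑[_]_     : Carrier → Ord → Carrier → Set ℓ
    ⊑-preorder : ∀ α → IsPreorder _≡_ (λ x y → x ⊑[ α ] y)

  _=[_]_ : Carrier → Ord → Carrier → Set ℓ
  x =[ α ] y = x ⊑[ α ] y × y ⊑[ α ] x

  ⋁ : Pred Carrier ℓ → Carrier
  ⋁ S = Data.Product.proj₁ (Data.Product.proj₂ ≤-complete S)

  field
    A1 : ∀ {α β x y} → α < β → x ⊑[ β ] y → x =[ α ] y
    A2 : ∀ {x y} → (∀ α → x =[ α ] y) → x ≡ y
    _∣_        : Carrier → Ord → Carrier
    A3-eq      : ∀ x α → x =[ α ] (x ∣ α)
    A3-least   : ∀ {x α z} → x ⊑[ α ] z → (x ∣ α) ≤ z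
    -- (A4) for nonempty I and x_i =_α y (i ∈ I), ⋁ x_i =_α y
    A4 : ∀ {α} {I : Set ℓ} (x : I → Carrier) {y} → I →
         (∀ i → x i =[ α ] y) → ⋁ (Image x) =[ α ] y
    A5 : ∀ {x y α} → x ≤ y → (x ∣ α) ≤ (y ∣ α)
    A6 : ∀ {x y α} → x ≤ y → (∀ β → β < α → x =[ β ] y) → x ⊑[ α ] y

  _⊑_ : Carrier → Carrier → Set ℓ
  x ⊑ y = x ≡ y ⊎ Σ Ord (λ α → x ⊑[ α ] y × ¬ (y ⊑[ α ] x))

module Submission where

-- We work with the truncations  x ≼[ α ] y  of ⊑: x ⊑_α y, or x lies
-- strictly below y at some level δ < α.
-- Module Completeness uses excluded middle: ≼[ α ] at every α gives ⊑ via
-- (A2), so ≤ ⊆ ⊑ by well-founded induction and (A6).  For X ⊆ L, an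
-- α-approximate lub is ≼[ α ]-above X and ≼[ α ]-below all ⊑-upper bounds;
-- it is unique up to =_α and exists by well-founded recursion (the limit of
-- the earlier ones, refined by the members of X surviving up to α).  The
-- limit of all approximate lubs is the least upper bound.

open import Defs
open import Level using (Level)
open import Axiom.ExcludedMiddle using (ExcludedMiddle)
open import Axiom.DoubleNegationElimination using (em⇒dne)
open import Data.Product using (Σ; _×_; _,_; proj₁; proj₂)
open import Data.Sum using (_⊎_; inj₁; inj₂)
open import Data.Empty using (⊥; ⊥-elim)
open import Relation.Nullary using (¬_; Dec; yes; no)
open import Relation.Binary.PropositionalEquality using (_≡_; refl; sym; subst; isEquivalence)
open import Relation.Binary.Structures using (IsPreorder; IsPartialOrder; IsStrictTotalOrder)
open import Relation.Binary.Definitions using (tri<; tri≈; tri>)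
open import Relation.Unary using (Pred)
open import Induction.WellFounded using (Acc; acc)

module Classical {ℓ : Level} (em : ExcludedMiddle ℓ) where

  ¬∀⇒∃¬ : {A : Set ℓ} {P : A → Set ℓ} → ¬ (∀ a → P a) → Σ A (λ a → ¬ P a)
  ¬∀⇒∃¬ fails = em⇒dne em (λ none → fails (λ a → em⇒dne em (λ ¬Pa → none (a , ¬Pa))))

  ¬∀⇒∃¬-bounded : {A : Set ℓ} {Q P : A → Set ℓ} →
                  ¬ (∀ a → Q a → P a) → Σ A (λ a → Q a × ¬ P a)
  ¬∀⇒∃¬-bounded {Q = Q} {P} fails with ¬∀⇒∃¬ {P = λ a → Q a → P a} fails
  ... | a , ¬imp = a , em⇒dne em (λ ¬Qa → ¬imp (λ Qa → ⊥-elim (¬Qa Qa))) , λ Pa → ¬imp (λ _ → Pa)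

module Layers {ℓ : Level} (κ : LimitOrdinal ℓ) (M : Model κ) where
  open LimitOrdinal κ
  open Model M

  <-trans : ∀ {α β γ} → α < β → β < γ → α < γ
  <-trans = IsStrictTotalOrder.trans isSTO

  _≤o_ : Ord → Ord → Set ℓ
  α ≤o β = α < β ⊎ α ≡ β

  ≤-refl : ∀ {x} → x ≤ x
  ≤-refl = IsPreorder.reflexive (IsPartialOrder.isPreorder (proj₁ ≤-complete)) refl

  ≤-trans : ∀ {x y z} → x ≤ y → y ≤ z → x ≤ z
  ≤-trans = IsPreorder.trans (IsPartialOrder.isPreorder (proj₁ ≤-complete))

  ≤-antisym : ∀ {x y} → x ≤ y → y ≤ x → x ≡ y
  ≤-antisym = IsPartialOrder.antisym (proj₁ ≤-complete)

  ⋁-upper : ∀ S {x} → S x → x ≤ ⋁ S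
  ⋁-upper S {x} x∈S = proj₁ (proj₂ (proj₂ ≤-complete S)) x x∈S

  ⋁-least : ∀ S {v} → IsUpperBound _≤_ S v → ⋁ S ≤ v
  ⋁-least S {v} v-ub = proj₂ (proj₂ (proj₂ ≤-complete S)) v v-ub

  ⋁-dominated : {I J : Set ℓ} (f : I → Carrier) (g : J → Carrier) →
                (∀ i → Σ J (λ j → f i ≤ g j)) → ⋁ (Image f) ≤ ⋁ (Image g)
  ⋁-dominated f g dom = ⋁-least (Image f) λ { _ (i , refl) →
    ≤-trans (proj₂ (dom i)) (⋁-upper (Image g) (proj₁ (dom i) , refl)) }

  ⋁-mutual : {I J : Set ℓ} (f : I → Carrier) (g : J → Carrier) →
             (∀ i → Σ J (λ j → f i ≤ g j)) → (∀ j → Σ I (λ i → g j ≤ f i)) →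
             ⋁ (Image f) ≡ ⋁ (Image g)
  ⋁-mutual f g f≼g g≼f = ≤-antisym (⋁-dominated f g f≼g) (⋁-dominated g f g≼f)

  ⊑α-refl : ∀ {α x} → x ⊑[ α ] x
  ⊑α-refl {α} = IsPreorder.reflexive (⊑-preorder α) refl

  ⊑α-trans : ∀ {α x y z} → x ⊑[ α ] y → y ⊑[ α ] z → x ⊑[ α ] z
  ⊑α-trans {α} = IsPreorder.trans (⊑-preorder α)

  =α-refl : ∀ {α x} → x =[ α ] x
  =α-refl = ⊑α-refl , ⊑α-refl

  =α-sym : ∀ {α x y} → x =[ α ] y → y =[ α ] x
  =α-sym (p , q) = q , p

  =α-trans : ∀ {α x y z} → x =[ α ] y → y =[ α ] z → x =[ α ] z
  =α-trans (p , q) (p′ , q′) = ⊑α-trans p p′ , ⊑α-trans q′ q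

  ⊑-lower : ∀ {β γ x y} → β < γ → x ⊑[ γ ] y → x ⊑[ β ] y
  ⊑-lower β<γ p = proj₁ (A1 β<γ p)

  =-lower : ∀ {β γ x y} → β < γ → x =[ γ ] y → x =[ β ] y
  =-lower β<γ e = A1 β<γ (proj₁ e)

  =-lower≤ : ∀ {β γ x y} → β ≤o γ → x =[ γ ] y → x =[ β ] y
  =-lower≤ (inj₁ β<γ) e = =-lower β<γ e
  =-lower≤ (inj₂ refl) e = e

  restrict-≤ : ∀ {x α} → (x ∣ α) ≤ x
  restrict-≤ = A3-least ⊑α-refl

  restrict-cong : ∀ {x y α} → x =[ α ] y → (x ∣ α) ≡ (y ∣ α)
  restrict-cong {x} {y} {α} (x⊑y , y⊑x) =
    ≤-antisym (A3-least (⊑α-trans x⊑y (proj₁ (A3-eq y α))))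
              (A3-least (⊑α-trans y⊑x (proj₁ (A3-eq x α))))

  restrict-grows : ∀ {z β γ} → β ≤o γ → (z ∣ β) ≤ (z ∣ γ)
  restrict-grows {z} {γ = γ} (inj₁ β<γ) = A3-least (⊑-lower β<γ (proj₁ (A3-eq z γ)))
  restrict-grows (inj₂ refl) = ≤-refl

  StrictAt : Ord → Carrier → Carrier → Set ℓ
  StrictAt δ x y = x ⊑[ δ ] y × ¬ (y ⊑[ δ ] x)

  strict-respʳ : ∀ {δ x w w′} → StrictAt δ x w → w =[ δ ] w′ → StrictAt δ x w′
  strict-respʳ (p , ¬q) (w⊑w′ , w′⊑w) = ⊑α-trans p w⊑w′ , λ q → ¬q (⊑α-trans w⊑w′ q)

  strict-respˡ : ∀ {δ w w′ y} → w =[ δ ] w′ → StrictAt δ w′ y → StrictAt δ w y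
  strict-respˡ (w⊑w′ , w′⊑w) (p , ¬q) = ⊑α-trans w⊑w′ p , λ q → ¬q (⊑α-trans q w⊑w′)

  -- Strict separations in opposite directions clash at the lower level.
  strict-asym : ∀ {δ δ′ x y} → StrictAt δ x y → StrictAt δ′ y x → ⊥
  strict-asym {δ} {δ′} (p , ¬q) (q , ¬p) with IsStrictTotalOrder.compare isSTO δ δ′
  ... | tri< δ<δ′ _ _ = ¬q (⊑-lower δ<δ′ q)
  ... | tri≈ _ refl _ = ¬q q
  ... | tri> _ _ δ′<δ = ¬p (⊑-lower δ′<δ p)

  ⊑-trans : ∀ {x y z} → x ⊑ y → y ⊑ z → x ⊑ z
  ⊑-trans (inj₁ refl) y⊑z = y⊑z
  ⊑-trans (inj₂ s) (inj₁ refl) = inj₂ s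
  ⊑-trans (inj₂ (α , s)) (inj₂ (β , t)) with IsStrictTotalOrder.compare isSTO α β
  ... | tri< α<β _ _ = inj₂ (α , strict-respʳ s (A1 α<β (proj₁ t)))
  ... | tri≈ _ refl _ = inj₂ (α , ⊑α-trans (proj₁ s) (proj₁ t) ,
                                  λ z⊑x → proj₂ t (⊑α-trans z⊑x (proj₁ s)))
  ... | tri> _ _ β<α = inj₂ (β , strict-respˡ (A1 β<α (proj₁ s)) t)

  ⊑-antisym : ∀ {x y} → x ⊑ y → y ⊑ x → x ≡ y
  ⊑-antisym (inj₁ x≡y) _ = x≡y
  ⊑-antisym (inj₂ _) (inj₁ y≡x) = sym y≡x
  ⊑-antisym (inj₂ (_ , s)) (inj₂ (_ , t)) = ⊥-elim (strict-asym s t)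

  ⊑-isPartialOrder : IsPartialOrder _≡_ _⊑_
  ⊑-isPartialOrder = record
    { isPreorder = record { isEquivalence = isEquivalence ; reflexive = inj₁ ; trans = ⊑-trans }
    ; antisym    = ⊑-antisym
    }

  StrictBelow : Ord → Carrier → Carrier → Set ℓ
  StrictBelow α x y = Σ Ord (λ δ → δ < α × StrictAt δ x y)

  _≼[_]_ : Carrier → Ord → Carrier → Set ℓ
  x ≼[ α ] y = x ⊑[ α ] y ⊎ StrictBelow α x y

  ≼-lower : ∀ {β γ x y} → β < γ → x ≼[ γ ] y → x ≼[ β ] y
  ≼-lower β<γ (inj₁ p) = inj₁ (⊑-lower β<γ p)
  ≼-lower {β} β<γ (inj₂ (δ , δ<γ , s)) with IsStrictTotalOrder.compare isSTO δ β
  ... | tri< δ<β _ _ = inj₂ (δ , δ<β , s)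
  ... | tri≈ _ refl _ = inj₁ (proj₁ s)
  ... | tri> _ _ β<δ = inj₁ (⊑-lower β<δ (proj₁ s))

  ≼-lower≤ : ∀ {β γ x y} → β ≤o γ → x ≼[ γ ] y → x ≼[ β ] y
  ≼-lower≤ (inj₁ β<γ) = ≼-lower β<γ
  ≼-lower≤ (inj₂ refl) p = p

  ≼-respʳ : ∀ {α x w w′} → x ≼[ α ] w → w =[ α ] w′ → x ≼[ α ] w′
  ≼-respʳ (inj₁ p) e = inj₁ (⊑α-trans p (proj₁ e))
  ≼-respʳ (inj₂ (δ , δ<α , s)) e = inj₂ (δ , δ<α , strict-respʳ s (=-lower δ<α e))

  ≼-respˡ : ∀ {α w w′ y} → w =[ α ] w′ → w′ ≼[ α ] y → w ≼[ α ] y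
  ≼-respˡ e (inj₁ p) = inj₁ (⊑α-trans (proj₁ e) p)
  ≼-respˡ e (inj₂ (δ , δ<α , s)) = inj₂ (δ , δ<α , strict-respˡ (=-lower δ<α e) s)

  ≼-antisym : ∀ {α x y} → x ≼[ α ] y → y ≼[ α ] x → x =[ α ] y
  ≼-antisym (inj₁ p) (inj₁ q) = p , q
  ≼-antisym (inj₁ p) (inj₂ (δ , δ<α , _ , ¬p)) = ⊥-elim (¬p (⊑-lower δ<α p))
  ≼-antisym (inj₂ (δ , δ<α , _ , ¬q)) (inj₁ q) = ⊥-elim (¬q (⊑-lower δ<α q))
  ≼-antisym (inj₂ (_ , _ , s)) (inj₂ (_ , _ , t)) = ⊥-elim (strict-asym s t)

  ≼-sharpen : ∀ {α β x y} → β < α → x ≼[ β ] y → ¬ (x =[ β ] y) → StrictBelow α x y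
  ≼-sharpen {β = β} β<α (inj₁ p) ¬e = β , β<α , p , λ q → ¬e (p , q)
  ≼-sharpen β<α (inj₂ (δ , δ<β , s)) _ = δ , <-trans δ<β β<α , s

  module CoherentFamily {J : Set ℓ} (level : J → Ord) (f : J → Carrier)
                        (coherent : ∀ i j → level i ≤o level j → f j =[ level i ] f i) where

    floor : J → Carrier
    floor i = f i ∣ level i

    floor-mono : ∀ i j → level i ≤o level j → floor i ≤ floor j
    floor-mono i j i≤j =
      subst (_≤ floor j) (sym (restrict-cong (=α-sym (coherent i j i≤j)))) (restrict-grows i≤j)

    limit : Carrier
    limit = ⋁ (Image floor)

    -- At level i only the floors from level i upwards matter; they all
    -- agree with f i there, so (A4) applies to their join, which is the limit.
    limit-agrees : ∀ i → limit =[ level i ] f i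
    limit-agrees i = subst (λ w → w =[ level i ] f i) join-above-is-limit
                           (A4 floor-above (i , inj₂ refl) floor-above-agrees)
      where
      Above : Set ℓ
      Above = Σ J (λ j → level i ≤o level j)

      floor-above : Above → Carrier
      floor-above (j , _) = floor j

      floor-above-agrees : ∀ k → floor-above k =[ level i ] f i
      floor-above-agrees (j , i≤j) =
        =α-trans (=-lower≤ i≤j (=α-sym (A3-eq (f j) (level j)))) (coherent i j i≤j)

      dominated : ∀ j → Σ Above (λ k → floor j ≤ floor-above k)
      dominated j with IsStrictTotalOrder.compare isSTO (level j) (level i)
      ... | tri< j<i _ _ = (i , inj₂ refl) , floor-mono j i (inj₁ j<i)
      ... | tri≈ _ j≡i _ = (j , inj₂ (sym j≡i)) , ≤-refl
      ... | tri> _ _ i<j = (j , inj₁ i<j) , ≤-refl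

      join-above-is-limit : ⋁ (Image floor-above) ≡ limit
      join-above-is-limit = ⋁-mutual floor-above floor (λ k → proj₁ k , ≤-refl) dominated

    limit-least : ∀ v → (∀ i → v =[ level i ] f i) → limit ≤ v
    limit-least v v-agrees = ⋁-least (Image floor) λ { _ (i , refl) →
      subst (_≤ v) (restrict-cong (v-agrees i)) restrict-≤ }

module Completeness {ℓ : Level} (em : ExcludedMiddle ℓ) (κ : LimitOrdinal ℓ) (M : Model κ) where
  open LimitOrdinal κ
  open Model M
  open Layers κ M
  open Classical em

  ≼-extend : ∀ {α x y} → (∀ β → β < α → x ≼[ β ] y) →
             ((∀ β → β < α → x =[ β ] y) → x ⊑[ α ] y) → x ≼[ α ] y
  ≼-extend {α} {x} {y} below agreement⇒⊑ with em {StrictBelow α x y}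
  ... | yes s = inj₂ s
  ... | no ¬s = inj₁ (agreement⇒⊑ agree)
    where
    agree : ∀ β → β < α → x =[ β ] y
    agree β β<α with em {x =[ β ] y}
    ... | yes e = e
    ... | no ¬e = ⊥-elim (¬s (≼-sharpen β<α (below β β<α) ¬e))

  -- ⊑ is recovered from its truncations: by (A2), distinct elements
  -- disagree at some level, and there ≼ turns into strict separation.
  ≼-all⇒⊑ : ∀ {x y} → (∀ α → x ≼[ α ] y) → x ⊑ y
  ≼-all⇒⊑ {x} {y} ≼-everywhere with em {x ≡ y}
  ... | yes x≡y = inj₁ x≡y
  ... | no x≢y with ¬∀⇒∃¬ {P = λ α → x =[ α ] y} (λ agree → x≢y (A2 agree))
  ...   | α , ¬e with noGreatest α
  ...     | α′ , α<α′ with ≼-sharpen α<α′ (≼-everywhere α) ¬e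
  ...       | δ , _ , s = inj₂ (δ , s)

  ≤⇒≼ : ∀ {x y} → x ≤ y → ∀ α → Acc _<_ α → x ≼[ α ] y
  ≤⇒≼ x≤y α (acc rec) = ≼-extend (λ β β<α → ≤⇒≼ x≤y β (rec β<α)) (A6 x≤y)

  ≤⇒⊑ : ∀ {x y} → x ≤ y → x ⊑ y
  ≤⇒⊑ x≤y = ≼-all⇒⊑ (λ α → ≤⇒≼ x≤y α (wf α))

  module Supremum (X : Pred Carrier ℓ) where

    ApproxLub : Ord → Carrier → Set ℓ
    ApproxLub α y = (∀ x → X x → x ≼[ α ] y) × (∀ v → IsUpperBound _⊑_ X v → y ≼[ α ] v)

    approx-lower : ∀ {β γ y} → β ≤o γ → ApproxLub γ y → ApproxLub β y
    approx-lower β≤γ (above , below) =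
      (λ x x∈X → ≼-lower≤ β≤γ (above x x∈X)) , (λ v v-ub → ≼-lower≤ β≤γ (below v v-ub))

    saturate : Ord → Carrier → Carrier
    saturate α w = ⋁ (Image {I = Σ Carrier (λ z → z =[ α ] w)} proj₁)

    saturate-agrees : ∀ α w → saturate α w =[ α ] w
    saturate-agrees α w = A4 proj₁ (w , =α-refl) proj₂

    -- Saturating an approximate least upper bound gives a true ⊑-upper bound:
    -- elements of X that are =_α-equal to it lie ≤-below it.
    saturate-upper : ∀ {α y} → ApproxLub α y → IsUpperBound _⊑_ X (saturate α y)
    saturate-upper {α} {y} (above , _) x x∈X with above x x∈X
    ... | inj₂ (δ , δ<α , s) = inj₂ (δ , strict-respʳ s (=-lower δ<α (=α-sym (saturate-agrees α y))))
    ... | inj₁ x⊑y with em {y ⊑[ α ] x}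
    ...   | yes y⊑x = ≤⇒⊑ (⋁-upper _ ((x , x⊑y , y⊑x) , refl))
    ...   | no ¬y⊑x = inj₂ (α , strict-respʳ (x⊑y , ¬y⊑x) (=α-sym (saturate-agrees α y)))

    approx-unique : ∀ {α y y′} → ApproxLub α y → ApproxLub α y′ → y =[ α ] y′
    approx-unique {α} {y} {y′} a a′ =
      ≼-antisym (≼-respʳ (proj₂ a _ (saturate-upper a′)) (saturate-agrees α y′))
                (≼-respʳ (proj₂ a′ _ (saturate-upper a)) (saturate-agrees α y))

    -- From approximate least upper bounds below α to one at α: take the
    -- limit of the earlier ones, and refine it by the restrictions to α of
    -- those elements of X that agree with the limit below α.
    module Extend (α : Ord) (earlier : ∀ β → β < α → Σ Carrier (ApproxLub β)) where

      Below : Set ℓ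
      Below = Σ Ord (λ β → β < α)

      y : Below → Carrier
      y (β , β<α) = proj₁ (earlier β β<α)

      y-approx : ∀ j → ApproxLub (proj₁ j) (y j)
      y-approx (β , β<α) = proj₂ (earlier β β<α)

      open CoherentFamily proj₁ y (λ i j i≤j → approx-unique (approx-lower i≤j (y-approx j)) (y-approx i))

      Survivor : Carrier → Set ℓ
      Survivor x = X x × (∀ β → β < α → x =[ β ] limit)

      candidate : Dec (Σ Carrier Survivor) → Carrier
      candidate (yes _) = ⋁ (Image {I = Σ Carrier Survivor} (λ s → proj₁ s ∣ α))
      candidate (no _) = limit

      candidate-agrees : ∀ d β → β < α → candidate d =[ β ] limit
      candidate-agrees (yes s) β β<α = A4 _ s λ { (x , _ , x≈) →
        =α-trans (=-lower β<α (=α-sym (A3-eq x α))) (x≈ β β<α) }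
      candidate-agrees (no _) β β<α = =α-refl

      survivor-⊑ : ∀ d {x} → Survivor x → x ⊑[ α ] candidate d
      survivor-⊑ (no none) s = ⊥-elim (none (_ , s))
      survivor-⊑ (yes some) {x} s@(_ , x≈) =
        ⊑α-trans (proj₁ (A3-eq x α)) (A6 (⋁-upper _ ((x , s) , refl)) agree)
        where
        agree : ∀ β → β < α → (x ∣ α) =[ β ] candidate (yes some)
        agree β β<α = =α-trans (=-lower β<α (=α-sym (A3-eq x α)))
                               (=α-trans (x≈ β β<α) (=α-sym (candidate-agrees (yes some) β β<α)))

      -- A non-survivor disagrees with the candidate at some β < α while
      -- lying ≼[ β ]-below it; hence it is strictly separated below α.
      candidate-above : ∀ d x → X x → x ≼[ α ] candidate d
      candidate-above d x x∈X with em {∀ β → β < α → x =[ β ] limit}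
      ... | yes x≈ = inj₁ (survivor-⊑ d (x∈X , x≈))
      ... | no ¬x≈ with ¬∀⇒∃¬-bounded ¬x≈
      ...   | β , β<α , ¬e = inj₂ (≼-sharpen β<α x≼cand (λ e → ¬e (=α-trans e (candidate-agrees d β β<α))))
        where
        x≼cand : x ≼[ β ] candidate d
        x≼cand = ≼-respʳ (proj₁ (y-approx (β , β<α)) x x∈X)
                         (=α-trans (=α-sym (limit-agrees (β , β<α))) (=α-sym (candidate-agrees d β β<α)))

      survivor-⊑-ub : ∀ {v} → IsUpperBound _⊑_ X v → (∀ β → β < α → v =[ β ] limit) →
                      ∀ {x} → Survivor x → x ⊑[ α ] v
      survivor-⊑-ub v-ub v≈ {x} (x∈X , x≈) with v-ub x x∈X
      ... | inj₁ refl = ⊑α-refl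
      ... | inj₂ (δ , x⊑v , ¬v⊑x) with IsStrictTotalOrder.compare isSTO δ α
      ...   | tri< δ<α _ _ = ⊥-elim (¬v⊑x (proj₂ (=α-trans (x≈ δ δ<α) (=α-sym (v≈ δ δ<α)))))
      ...   | tri≈ _ refl _ = x⊑v
      ...   | tri> _ _ α<δ = ⊑-lower α<δ x⊑v

      candidate-≤-ub : ∀ d {v} → IsUpperBound _⊑_ X v → (∀ β → β < α → v =[ β ] limit) →
                       candidate d ≤ v
      candidate-≤-ub (yes _) v-ub v≈ =
        ⋁-least _ λ { _ ((x , s) , refl) → A3-least (survivor-⊑-ub v-ub v≈ s) }
      candidate-≤-ub (no _) {v} v-ub v≈ =
        limit-least v (λ { (β , β<α) → =α-trans (v≈ β β<α) (limit-agrees (β , β<α)) })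

      candidate-below : ∀ d v → IsUpperBound _⊑_ X v → candidate d ≼[ α ] v
      candidate-below d v v-ub = ≼-extend earlier-≼ agreement⇒⊑
        where
        earlier-≼ : ∀ β → β < α → candidate d ≼[ β ] v
        earlier-≼ β β<α = ≼-respˡ (=α-trans (candidate-agrees d β β<α) (limit-agrees (β , β<α)))
                                  (proj₂ (y-approx (β , β<α)) v v-ub)
        agreement⇒⊑ : (∀ β → β < α → candidate d =[ β ] v) → candidate d ⊑[ α ] v
        agreement⇒⊑ agree = A6 (candidate-≤-ub d v-ub v≈) agree
          where
          v≈ : ∀ β → β < α → v =[ β ] limit
          v≈ β β<α = =α-trans (=α-sym (agree β β<α)) (candidate-agrees d β β<α)

      approx-at : Σ Carrier (ApproxLub α)
      approx-at = candidate em , candidate-above em , candidate-below em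

    approx-exists : ∀ α → Acc _<_ α → Σ Carrier (ApproxLub α)
    approx-exists α (acc rec) = Extend.approx-at α (λ β β<α → approx-exists β (rec β<α))

    approx : Ord → Carrier
    approx α = proj₁ (approx-exists α (wf α))

    approx-is : ∀ α → ApproxLub α (approx α)
    approx-is α = proj₂ (approx-exists α (wf α))

    lub : Σ Carrier (IsLub _⊑_ X)
    lub = limit , upper , least
      where
      open CoherentFamily (λ α → α) approx
             (λ β γ β≤γ → approx-unique (approx-lower β≤γ (approx-is γ)) (approx-is β))
      upper : IsUpperBound _⊑_ X limit
      upper x x∈X = ≼-all⇒⊑ (λ α → ≼-respʳ (proj₁ (approx-is α) x x∈X) (=α-sym (limit-agrees α)))
      least : ∀ v → IsUpperBound _⊑_ X v → limit ⊑ v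
      least v v-ub = ≼-all⇒⊑ (λ α → ≼-respˡ (limit-agrees α) (proj₂ (approx-is α) v v-ub))

  ⊑-complete : IsCompleteLattice _⊑_
  ⊑-complete = ⊑-isPartialOrder , Supremum.lub

corollary20 : {ℓ : Level} → ExcludedMiddle ℓ → (κ : LimitOrdinal ℓ) (M : Model κ) →
    IsCompleteLattice (Model._⊑_ M)
corollary20 em κ M = Completeness.⊑-complete em κ M
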